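{- For every integer $a\ge 2$, $$\beta_b(C(2a+1;1,a))=\begin{cases}a-1, & \text{if } a=2 \text{ or } a\equiv 4\pmod 6,\\ 2\left(\left\lceil\dfrac{a}{2}\right\rceil-1\right), & \text{otherwise.}\end{cases}$$
   Context: For integers $n\ge 3$ and $1\le a\le\lfloor n/2\rfloor$, the circulant graph $C(n;1,a)$ has vertex set $\{v_0,\dots,v_{n-1}\}$ and edges $v_iv_{i+1}$ and $v_iv_{i+a}$, subscripts modulo $n$. For a connected graph $G$, a broadcast is a function $f:V(G)\to\{0,\dots,\mathrm{diam}(G)\}$ with $f(v)\le e(v)$ (eccentricity) for all $v$; $V_f^+=\{v:f(v)>0\}$. $f$ is independent if $d(u,v)>\max\{f(u),f(v)\}$ for all distinct $u,v\in V_f^+$. The cost is $\sigma(f)=\sum_v f(v)$, and $\beta_b(G)$ is the maximum cost of an independent broadcast on $G$. -}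

module Defs where

open import Data.Nat using (ℕ; zero; suc; _+_; _*_; _≤_; _<_; _⊔_; NonZero)
open import Data.Nat.DivMod using (_%_)
open import Data.Nat.ListAction using (sum)
open import Data.Fin using (Fin; toℕ)
open import Data.List using (map)
open import Data.List using () renaming (allFin to allFinL)
open import Data.Product using (Σ; ∃; _×_)
open import Data.Sum using (_⊎_)
open import Relation.Binary.PropositionalEquality using (_≡_; _≢_)
open import Relation.Nullary using (¬_)

Graph : ℕ → Set₁
Graph n = Fin n → Fin n → Set

Circulant : (n a : ℕ) → .{{_ : NonZero n}} → Graph n
Circulant n a i j =
  ((toℕ i + 1) % n ≡ toℕ j) ⊎ ((toℕ j + 1) % n ≡ toℕ i) ⊎
  ((toℕ i + a) % n ≡ toℕ j) ⊎ ((toℕ j + a) % n ≡ toℕ i)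

data Walk {n : ℕ} (G : Graph n) : Fin n → Fin n → ℕ → Set where
  here : ∀ {u} → Walk G u u 0
  step : ∀ {u w v k} → G u w → Walk G w v k → Walk G u v (suc k)

Dist : ∀ {n} → Graph n → Fin n → Fin n → ℕ → Set
Dist G u v d = Walk G u v d × (∀ k → k < d → ¬ Walk G u v k)

-- f(v) ≤ e(v), where e(v) = max_u d(v,u): some vertex u is at distance ≥ f(v).
BoundedByEcc : ∀ {n} → Graph n → Fin n → ℕ → Set
BoundedByEcc G v m = ∃ λ u → ∃ λ d → Dist G v u d × m ≤ d

IsBroadcast : ∀ {n} → Graph n → (Fin n → ℕ) → Set
IsBroadcast G f = ∀ v → BoundedByEcc G v (f v)

IsIndependentBroadcast : ∀ {n} → Graph n → (Fin n → ℕ) → Set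
IsIndependentBroadcast G f =
  IsBroadcast G f ×
  (∀ u v → u ≢ v → 0 < f u → 0 < f v → ∀ d → Dist G u v d → (f u ⊔ f v) < d)

cost : ∀ {n} → (Fin n → ℕ) → ℕ
cost {n} f = sum (map f (allFinL n))

IndepBroadcastNumberIs : ∀ {n} → Graph n → ℕ → Set
IndepBroadcastNumberIs {n} G m =
  (Σ (Fin n → ℕ) λ f → IsIndependentBroadcast G f × cost f ≡ m) ×
  (∀ (f : Fin n → ℕ) → IsIndependentBroadcast G f → cost f ≤ m)

-- The map u ↦ 2u mod N (N = 2a + 1) is an isomorphism from C(N; 1, a) onto C(N; 1, 2), since
-- 2a ≡ -1; in the latter, vertices whose positions are g apart around the cycle are at distance ⌈g/2⌉.
-- Hence broadcasting vertices of strengths p and q must be at least 2 max(p, q) + 1 apart in both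
-- directions, and these clearances, summed once around the cycle of broadcasting positions, are at
-- most N = 2a + 1, while a lone broadcaster is bounded by the eccentricity ⌈a/2⌉. This bounds the cost
-- by a - 1, and even by 2(⌈a/2⌉ - 1) except when a = 2 or three equal strengths p fill the cycle
-- exactly, 6p + 3 = 2a + 1 with a even, which is a ≡ 4 (mod 6). The bounds are attained by two
-- broadcasters of strength ⌈a/2⌉ - 1 at positions 0 and 2⌈a/2⌉, by three equally spaced ones when
-- a ≡ 4 (mod 6), and by a single one of strength 1 when a = 2.

module Submission where

open import Defs
open import Data.Nat using (ℕ; zero; suc; _+_; _*_; _∸_; _≤_; _<_; _>_; _⊔_; ⌈_/2⌉; NonZero; >-nonZero⁻¹; z≤n; s≤s; s≤s⁻¹; _≟_; _≤?_; _<?_)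
open import Data.Nat.Properties
open import Data.Nat.DivMod using (_%_; _/_; m≡m%n+[m/n]*n; m%n<n; [m+kn]%n≡m%n)
open import Data.Nat.Tactic.RingSolver using (solve-∀)
open import Data.Product as Product using (Σ; ∃; ∃₂; _×_; _,_; proj₁; proj₂)
open import Data.Sum as Sum using (_⊎_; inj₁; inj₂)
open import Data.Empty using (⊥-elim)
open import Data.List using (List; []; _∷_; map; tabulate; length)
open import Data.List.Properties using (map-tabulate)
open import Data.List.Relation.Unary.All as All using (All; []; _∷_)
open import Data.List.Relation.Unary.AllPairs as AllPairs using (AllPairs; []; _∷_)
open import Data.List.Relation.Unary.Any using (here; there)
open import Data.List.Membership.Propositional using (_∈_)
open import Data.Nat.ListAction using (sum)
open import Data.Fin as Fin using (Fin; toℕ; fromℕ; fromℕ<; inject₁)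
open import Data.Fin.Properties using (toℕ-fromℕ; toℕ-inject₁; toℕ-fromℕ<; toℕ-injective; toℕ<n; any?)
open import Data.Fin.Permutation using (permutation)
open import Algebra.Properties.CommutativeMonoid.Sum +-0-commutativeMonoid
  using (sum-permute; sum-init-last; sum-cong-≗) renaming (sum to ∑)
open import Function using (_∘_; id)
open import Level using (0ℓ)
open import Relation.Binary using (Rel; IsEquivalence; Setoid)
import Relation.Binary.Reasoning.Setoid as SetoidReasoning
open import Relation.Binary.PropositionalEquality
open import Relation.Nullary using (¬_; Dec; yes; no)
open import Relation.Nullary.Decidable using (_⊎-dec_; _×-dec_)
open import Relation.Binary.Definitions using (tri<; tri≈; tri>)
open import Data.Unit using (⊤; tt)

module Congruence (N : ℕ) .{{_ : NonZero N}} where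

  infix 4 _≋_

  _≋_ : Rel ℕ 0ℓ
  x ≋ y = ∃₂ λ p q → x + p * N ≡ y + q * N

  ≋-reflexive : ∀ {x y} → x ≡ y → x ≋ y
  ≋-reflexive refl = 0 , 0 , refl

  ≋-refl : ∀ {x} → x ≋ x
  ≋-refl = ≋-reflexive refl

  ≋-sym : ∀ {x y} → x ≋ y → y ≋ x
  ≋-sym (p , q , e) = q , p , sym e

  private
    regroup : ∀ x p r N → x + (p + r) * N ≡ x + p * N + r * N
    regroup = solve-∀
    swap : ∀ x y z → x + y + z ≡ x + z + y
    swap = solve-∀
    interchange : ∀ x x′ p r N → x + x′ + (p + r) * N ≡ (x + p * N) + (x′ + r * N)
    interchange = solve-∀
    distrib : ∀ c x p N → c * (x + p * N) ≡ c * x + c * p * N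
    distrib = solve-∀

  ≋-trans : ∀ {x y z} → x ≋ y → y ≋ z → x ≋ z
  ≋-trans {x} {y} {z} (p , q , e₁) (r , s , e₂) = p + r , s + q , (begin
    x + (p + r) * N      ≡⟨ regroup x p r N ⟩
    (x + p * N) + r * N  ≡⟨ cong (_+ r * N) e₁ ⟩
    (y + q * N) + r * N  ≡⟨ swap y (q * N) (r * N) ⟩
    (y + r * N) + q * N  ≡⟨ cong (_+ q * N) e₂ ⟩
    (z + s * N) + q * N  ≡⟨ regroup z s q N ⟨
    z + (s + q) * N      ∎)
    where open ≡-Reasoning

  ≋-isEquivalence : IsEquivalence _≋_
  ≋-isEquivalence = record { refl = ≋-refl ; sym = ≋-sym ; trans = ≋-trans }

  ≋-setoid : Setoid 0ℓ 0ℓ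
  ≋-setoid = record { isEquivalence = ≋-isEquivalence }

  +-cong-≋ : ∀ {x y x′ y′} → x ≋ y → x′ ≋ y′ → x + x′ ≋ y + y′
  +-cong-≋ {x} {y} {x′} {y′} (p , q , e₁) (r , s , e₂) = p + r , q + s , (begin
    x + x′ + (p + r) * N         ≡⟨ interchange x x′ p r N ⟩
    (x + p * N) + (x′ + r * N)   ≡⟨ cong₂ _+_ e₁ e₂ ⟩
    (y + q * N) + (y′ + s * N)   ≡⟨ interchange y y′ q s N ⟨
    y + y′ + (q + s) * N         ∎)
    where open ≡-Reasoning

  module ≋-Reasoning = SetoidReasoning ≋-setoid

  +-congʳ-≋ : ∀ {x y} s → x ≋ y → x + s ≋ y + s
  +-congʳ-≋ s x≋y = +-cong-≋ x≋y ≋-refl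

  *-congˡ-≋ : ∀ c {x y} → x ≋ y → c * x ≋ c * y
  *-congˡ-≋ c {x} {y} (p , q , e) = c * p , c * q , (begin
    c * x + c * p * N   ≡⟨ distrib c x p N ⟨
    c * (x + p * N)     ≡⟨ cong (c *_) e ⟩
    c * (y + q * N)     ≡⟨ distrib c y q N ⟩
    c * y + c * q * N   ∎)
    where open ≡-Reasoning

  +-cancelʳ-≋ : ∀ {x y} s → x + s ≋ y + s → x ≋ y
  +-cancelʳ-≋ {x} {y} s (p , q , e) = p , q , +-cancelʳ-≡ s (x + p * N) (y + q * N) (begin
    x + p * N + s  ≡⟨ swap x (p * N) s ⟩
    x + s + p * N  ≡⟨ e ⟩
    y + s + q * N  ≡⟨ swap y s (q * N) ⟩
    y + q * N + s  ∎)
    where open ≡-Reasoning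

  +-cancelˡ-≋ : ∀ {x y} s → s + x ≋ s + y → x ≋ y
  +-cancelˡ-≋ {x} {y} s e = +-cancelʳ-≋ s (subst₂ _≋_ (+-comm s x) (+-comm s y) e)

  m+kN≋m : ∀ m k → m + k * N ≋ m
  m+kN≋m m k = 0 , k , +-identityʳ (m + k * N)

  m+N≋m : ∀ m → m + N ≋ m
  m+N≋m m = 0 , 1 , trans (+-identityʳ (m + N)) (cong (m +_) (sym (+-identityʳ N)))

  m%N≋m : ∀ m → m % N ≋ m
  m%N≋m m = m / N , 0 , trans (sym (m≡m%n+[m/n]*n m N)) (sym (+-identityʳ m))

  private
    quotient-mono : ∀ {x y p q} → x < N → x + p * N ≡ y + q * N → q ≤ p
    quotient-mono {x} {y} {p} {q} x<N e with q ≤? p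
    ... | yes q≤p = q≤p
    ... | no q≰p = ⊥-elim (<-irrefl refl (begin-strict
          suc p * N    ≤⟨ *-monoˡ-≤ N (≰⇒> q≰p) ⟩
          q * N        ≤⟨ m≤n+m (q * N) y ⟩
          y + q * N    ≡⟨ e ⟨
          x + p * N    <⟨ +-monoˡ-< (p * N) x<N ⟩
          suc p * N    ∎))
      where open ≤-Reasoning

  residue-≋ : ∀ {x y} → x < N → x ≋ y → x ≡ y ⊎ N ≤ y
  residue-≋ {x} {y} x<N (p , q , e) with m≤n⇒∃[o]m+o≡n (quotient-mono {x} {y} {p} {q} x<N e)
  ... | r , refl = from-excess r (+-cancelʳ-≡ (q * N) (x + r * N) y (trans (reassoc x r q) e))
    where
    reassoc : ∀ x r q → x + r * N + q * N ≡ x + (q + r) * N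
    reassoc x r q = trans (swap x (r * N) (q * N)) (sym (regroup x q r N))
    from-excess : ∀ r → x + r * N ≡ y → x ≡ y ⊎ N ≤ y
    from-excess zero    e′ = inj₁ (trans (sym (+-identityʳ x)) e′)
    from-excess (suc r) refl = inj₂ (≤-trans (m≤m+n N (r * N)) (m≤n+m (N + r * N) x))

  ≋⇒≡ : ∀ {x y} → x < N → y < N → x ≋ y → x ≡ y
  ≋⇒≡ x<N y<N x≋y with residue-≋ x<N x≋y
  ... | inj₁ x≡y = x≡y
  ... | inj₂ N≤y = ⊥-elim (<⇒≱ y<N N≤y)

  ≋-below : ∀ {s u} → s ≋ u → u ≤ s ⊎ N ≤ u
  ≋-below {s} {u} s≋u with u ≤? s
  ... | yes u≤s = inj₁ u≤s
  ... | no  u≰s with m≤n⇒∃[o]m+o≡n (<⇒≤ (≰⇒> u≰s))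
  ...   | e , refl with residue-≋ (>-nonZero⁻¹ N) (≋-sym (+-cancelˡ-≋ s (subst (s + e ≋_) (sym (+-identityʳ s)) (≋-sym s≋u))))
  ...     | inj₁ refl = ⊥-elim (u≰s (≤-reflexive (+-identityʳ s)))
  ...     | inj₂ N≤e  = inj₂ (≤-trans N≤e (m≤n+m e s))

least-witness : ∀ {P : ℕ → Set} → (∀ n → Dec (P n)) → ∀ {L} → P L →
  ∃ λ d → (P d × (∀ k → k < d → ¬ P k)) × d ≤ L
least-witness {P} P? {L} pL = search 0 (λ _ ()) L refl
  where
  search : ∀ m → (∀ k → k < m → ¬ P k) → ∀ r → m + r ≡ L → ∃ λ d → (P d × (∀ k → k < d → ¬ P k)) × d ≤ L
  search m below r m+r≡L with P? m
  ... | yes pm = m , (pm , below) , ≤-trans (m≤m+n m r) (≤-reflexive m+r≡L)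
  search m below zero    m+0≡L | no ¬pm = ⊥-elim (¬pm (subst P (trans (sym m+0≡L) (+-identityʳ m)) pL))
  search m below (suc r) m+r≡L | no ¬pm = search (suc m) below′ r (trans (sym (+-suc m r)) m+r≡L)
    where
    below′ : ∀ k → k < suc m → ¬ P k
    below′ k k<1+m with m≤n⇒m<n∨m≡n (s≤s⁻¹ k<1+m)
    ... | inj₁ k<m  = below k k<m
    ... | inj₂ refl = ¬pm

AllPairs-∈ : ∀ {R : ℕ → ℕ → Set} {xs x y} → AllPairs R xs → x ∈ xs → y ∈ xs → x ≢ y → R x y ⊎ R y x
AllPairs-∈ (_ ∷ _)        (here refl) (here refl) x≢y = ⊥-elim (x≢y refl)
AllPairs-∈ (Rx ∷ _)       (here refl) (there y∈) _    = inj₁ (All.lookup Rx y∈)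
AllPairs-∈ (Ry ∷ _)       (there x∈)  (here refl) _   = inj₂ (All.lookup Ry x∈)
AllPairs-∈ (_ ∷ pairs)    (there x∈)  (there y∈) x≢y = AllPairs-∈ pairs x∈ y∈ x≢y

sumBelow : ℕ → (ℕ → ℕ) → ℕ
sumBelow zero    g = 0
sumBelow (suc n) g = sumBelow n g + g n

sumBelow-cong : ∀ n {g h : ℕ → ℕ} → (∀ {x} → x < n → g x ≡ h x) → sumBelow n g ≡ sumBelow n h
sumBelow-cong zero    g≗h = refl
sumBelow-cong (suc n) g≗h = cong₂ _+_ (sumBelow-cong n (g≗h ∘ m<n⇒m<1+n)) (g≗h ≤-refl)

sum-tabulate : ∀ {n} (f : Fin n → ℕ) → sum (tabulate f) ≡ ∑ f
sum-tabulate {zero}  f = refl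
sum-tabulate {suc n} f = cong (f Fin.zero +_) (sum-tabulate (f ∘ Fin.suc))

cost≡∑ : ∀ {n} (f : Fin n → ℕ) → cost f ≡ ∑ f
cost≡∑ f = trans (cong sum (map-tabulate id f)) (sum-tabulate f)

∑∘toℕ≡sumBelow : ∀ n (g : ℕ → ℕ) → ∑ (g ∘ toℕ {n}) ≡ sumBelow n g
∑∘toℕ≡sumBelow zero    g = refl
∑∘toℕ≡sumBelow (suc n) g = begin
  ∑ (g ∘ toℕ {suc n})                          ≡⟨ sum-init-last {n} (g ∘ toℕ) ⟩
  ∑ {n} (g ∘ toℕ ∘ inject₁) + g (toℕ (fromℕ n)) ≡⟨ cong₂ _+_ init≡ (cong g (toℕ-fromℕ n)) ⟩
  sumBelow n g + g n                          ∎
  where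
  open ≡-Reasoning
  init≡ : ∑ {n} (g ∘ toℕ ∘ inject₁) ≡ sumBelow n g
  init≡ = trans (sum-cong-≗ {n} (λ i → cong g (toℕ-inject₁ i))) (∑∘toℕ≡sumBelow n g)

∑-bijection : ∀ {n} (f : Fin n → ℕ) (φ ψ : Fin n → Fin n) →
  (∀ i → φ (ψ i) ≡ i) → (∀ i → ψ (φ i) ≡ i) → ∑ f ≡ ∑ (f ∘ φ)
∑-bijection f φ ψ φ∘ψ ψ∘φ = sum-permute f (permutation φ ψ φ∘ψ ψ∘φ)

support : (ℕ → ℕ) → ℕ → List ℕ
support w zero = []
support w (suc n) with w n
... | zero  = support w n
... | suc _ = n ∷ support w n

sum-support : ∀ w n → sum (map w (support w n)) ≡ sumBelow n w
sum-support w zero = refl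
sum-support w (suc n) with w n in wn≡
... | zero  = trans (sum-support w n) (sym (+-identityʳ (sumBelow n w)))
... | suc k = trans (cong₂ _+_ wn≡ (sum-support w n)) (+-comm (suc k) (sumBelow n w))

support-valid : ∀ w n → All (λ x → x < n × 0 < w x) (support w n)
support-valid w zero = []
support-valid w (suc n) with w n in wn≡
... | zero  = All.map (Product.map₁ m<n⇒m<1+n) (support-valid w n)
... | suc _ = (≤-refl , subst (0 <_) (sym wn≡) (s≤s z≤n)) ∷ All.map (Product.map₁ m<n⇒m<1+n) (support-valid w n)

support-descending : ∀ w n → AllPairs _>_ (support w n)
support-descending w zero = []
support-descending w (suc n) with w n
... | zero  = support-descending w n
... | suc _ = All.map proj₁ (support-valid w n) ∷ support-descending w n

indicator : ℕ → ℕ → ℕ → ℕ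
indicator t c x with x ≟ c
... | yes _ = t
... | no  _ = 0

indicator-≢ : ∀ t {c x} → x ≢ c → indicator t c x ≡ 0
indicator-≢ t {c} {x} x≢c with x ≟ c
... | yes x≡c = ⊥-elim (x≢c x≡c)
... | no  _   = refl

spread : ℕ → List ℕ → ℕ → ℕ
spread t cs x = sum (map (λ c → indicator t c x) cs)

spread-∉ : ∀ t {x} cs → All (x ≢_) cs → spread t cs x ≡ 0
spread-∉ t []       []             = refl
spread-∉ t (c ∷ cs) (x≢c ∷ x∉cs) = cong₂ _+_ (indicator-≢ t x≢c) (spread-∉ t cs x∉cs)

spread-≤ : ∀ t {cs} x → AllPairs _≢_ cs → spread t cs x ≤ t
spread-≤ t {[]}     x []                = z≤n
spread-≤ t {c ∷ cs} x (c∉cs ∷ distinct) with x ≟ c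
... | yes refl = ≤-reflexive (trans (cong (t +_) (spread-∉ t cs c∉cs)) (+-identityʳ t))
... | no  _    = spread-≤ t x distinct

spread-pos : ∀ t cs x → 0 < spread t cs x → x ∈ cs
spread-pos t (c ∷ cs) x spread>0 with x ≟ c
... | yes x≡c = here x≡c
... | no  _   = there (spread-pos t cs x spread>0)

sumBelow-+ : ∀ n (g h : ℕ → ℕ) → sumBelow n (λ x → g x + h x) ≡ sumBelow n g + sumBelow n h
sumBelow-+ zero    g h = refl
sumBelow-+ (suc n) g h = trans (cong (_+ (g n + h n)) (sumBelow-+ n g h)) (interchange (sumBelow n g) (sumBelow n h) (g n) (h n))
  where
  interchange : ∀ a b c d → a + b + (c + d) ≡ a + c + (b + d)
  interchange = solve-∀

sumBelow-zero : ∀ n (g : ℕ → ℕ) → (∀ {x} → x < n → g x ≡ 0) → sumBelow n g ≡ 0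
sumBelow-zero zero    g _  = refl
sumBelow-zero (suc n) g g≡0 = cong₂ _+_ (sumBelow-zero n g (g≡0 ∘ m<n⇒m<1+n)) (g≡0 ≤-refl)

sumBelow-indicator : ∀ t {c n} → c < n → sumBelow n (indicator t c) ≡ t
sumBelow-indicator t {c} {suc n} c<1+n with n ≟ c
... | yes refl = cong (_+ t) (sumBelow-zero n (indicator t n) (λ x<n → indicator-≢ t (<⇒≢ x<n)))
... | no  n≢c  = trans (+-identityʳ _) (sumBelow-indicator t (≤∧≢⇒< (s≤s⁻¹ c<1+n) (n≢c ∘ sym)))

sumBelow-spread : ∀ t cs n → All (_< n) cs → sumBelow n (spread t cs) ≡ length cs * t
sumBelow-spread t []       n []            = sumBelow-zero n (λ _ → 0) (λ _ → refl)
sumBelow-spread t (c ∷ cs) n (c<n ∷ cs<n) =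
  trans (sumBelow-+ n (indicator t c) (spread t cs)) (cong₂ _+_ (sumBelow-indicator t c<n) (sumBelow-spread t cs n cs<n))

2*suc : ∀ n → 2 * suc n ≡ 2 + 2 * n
2*suc = solve-∀

half-≤ : ∀ {x y} → 2 * x ≤ suc (2 * y) → x ≤ y
half-≤ {x} {y} 2x≤1+2y with x ≤? y
... | yes x≤y = x≤y
... | no  x≰y = ⊥-elim (<-irrefl refl (begin-strict
      suc (2 * y)         <⟨ n<1+n (suc (2 * y)) ⟩
      suc (suc (2 * y))   ≡⟨ 2*suc y ⟨
      2 * suc y           ≤⟨ *-monoʳ-≤ 2 (≰⇒> x≰y) ⟩
      2 * x               ≤⟨ 2x≤1+2y ⟩
      suc (2 * y)         ∎))
  where open ≤-Reasoning

parity : ∀ n → ∃ λ s → n ≡ 2 * s ⊎ n ≡ suc (2 * s)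
parity zero = 0 , inj₁ refl
parity (suc zero) = 0 , inj₂ refl
parity (suc (suc n)) with parity n
... | s , inj₁ refl = suc s , inj₁ (sym (2*suc s))
... | s , inj₂ refl = suc s , inj₂ (cong suc (sym (2*suc s)))

2*⌈n/2⌉≡n⊎1+n : ∀ n → 2 * ⌈ n /2⌉ ≡ n ⊎ 2 * ⌈ n /2⌉ ≡ suc n
2*⌈n/2⌉≡n⊎1+n zero = inj₁ refl
2*⌈n/2⌉≡n⊎1+n (suc zero) = inj₂ refl
2*⌈n/2⌉≡n⊎1+n (suc (suc n)) with 2*⌈n/2⌉≡n⊎1+n n
... | inj₁ e = inj₁ (trans (2*suc ⌈ n /2⌉) (cong (2 +_) e))
... | inj₂ e = inj₂ (trans (2*suc ⌈ n /2⌉) (cong (2 +_) e))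

n≤2*⌈n/2⌉ : ∀ n → n ≤ 2 * ⌈ n /2⌉
n≤2*⌈n/2⌉ n with 2*⌈n/2⌉≡n⊎1+n n
... | inj₁ e = ≤-reflexive (sym e)
... | inj₂ e = ≤-trans (n≤1+n n) (≤-reflexive (sym e))

2*⌈n/2⌉≤1+n : ∀ n → 2 * ⌈ n /2⌉ ≤ suc n
2*⌈n/2⌉≤1+n n with 2*⌈n/2⌉≡n⊎1+n n
... | inj₁ e = ≤-trans (≤-reflexive e) (n≤1+n n)
... | inj₂ e = ≤-reflexive e

n≤2*m⇒⌈n/2⌉≤m : ∀ {n m} → n ≤ 2 * m → ⌈ n /2⌉ ≤ m
n≤2*m⇒⌈n/2⌉≤m {n} n≤2m = half-≤ (≤-trans (2*⌈n/2⌉≤1+n n) (s≤s n≤2m))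

2*m≤n⇒m≤⌈n/2⌉ : ∀ {m n} → 2 * m ≤ n → m ≤ ⌈ n /2⌉
2*m≤n⇒m≤⌈n/2⌉ {m} {n} 2m≤n = *-cancelˡ-≤ 2 (≤-trans 2m≤n (n≤2*⌈n/2⌉ n))

m<⌈n/2⌉⇒1+2m≤n : ∀ {m} n → m < ⌈ n /2⌉ → suc (2 * m) ≤ n
m<⌈n/2⌉⇒1+2m≤n {zero}  (suc n)       _               = s≤s z≤n
m<⌈n/2⌉⇒1+2m≤n {suc m} (suc (suc n)) (s≤s m<⌈n/2⌉) =
  ≤-trans (≤-reflexive (cong suc (2*suc m))) (s≤s (s≤s (m<⌈n/2⌉⇒1+2m≤n n m<⌈n/2⌉)))

1+2m≤2n⇒m<n : ∀ {m n} → suc (2 * m) ≤ 2 * n → m < n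
1+2m≤2n⇒m<n {m} {n} 1+2m≤2n = half-≤ (≤-trans (≤-reflexive (2*suc m)) (s≤s 1+2m≤2n))

m<n⇒m≤n∸1 : ∀ {m n} → m < n → m ≤ n ∸ 1
m<n⇒m≤n∸1 {n = suc n} = s≤s⁻¹

m+n≡o⇒m≤o : ∀ m {n o} → m + n ≡ o → m ≤ o
m+n≡o⇒m≤o m {n} refl = m≤m+n m n

+2≤2*⇒≤2*∸1 : ∀ {m h} → m + 2 ≤ 2 * h → m ≤ 2 * (h ∸ 1)
+2≤2*⇒≤2*∸1 {m} {zero}  m+2≤0 = ⊥-elim (m+1+n≢0 m (n≤0⇒n≡0 m+2≤0))
+2≤2*⇒≤2*∸1 {m} {suc h} m+2≤2+2h =
  +-cancelʳ-≤ 2 m (2 * h) (≤-trans m+2≤2+2h (≤-reflexive (trans (2*suc h) (+-comm 2 (2 * h)))))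

-- Clearances around a cycle of broadcasting vertices
clearance : ℕ → ℕ → ℕ
clearance p q = suc (2 * (p ⊔ q))

lastOr : ℕ → List ℕ → ℕ
lastOr p []       = p
lastOr _ (q ∷ qs) = lastOr q qs

pathClearance : List ℕ → ℕ
pathClearance (p ∷ q ∷ qs) = clearance p q + pathClearance (q ∷ qs)
pathClearance _            = 0

cycleClearance : ℕ → List ℕ → ℕ
cycleClearance p qs = pathClearance (p ∷ qs) + clearance p (lastOr p qs)

clearance-comm : ∀ p q → clearance p q ≡ clearance q p
clearance-comm p q = cong (λ m → suc (2 * m)) (⊔-comm p q)

lastOr-map : ∀ (f : ℕ → ℕ) x xs → lastOr (f x) (map f xs) ≡ f (lastOr x xs)
lastOr-map f x []       = refl
lastOr-map f x (y ∷ ys) = lastOr-map f y ys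

lastOr-All : ∀ {P : ℕ → Set} x xs → All P (x ∷ xs) → P (lastOr x xs)
lastOr-All x []       (px ∷ []) = px
lastOr-All x (y ∷ ys) (_ ∷ pys) = lastOr-All y ys pys

Admissible : ℕ → List ℕ → Set
Admissible a []           = ⊤
Admissible a (p ∷ [])     = p ≤ ⌈ a /2⌉
Admissible a (p ∷ q ∷ qs) = cycleClearance p (q ∷ qs) ≤ suc (2 * a)

p+q≤2*[p⊔q] : ∀ p q → p + q ≤ 2 * (p ⊔ q)
p+q≤2*[p⊔q] p q = +-mono-≤ (m≤m⊔n p q) (≤-trans (m≤n⊔m p q) (m≤m+n (p ⊔ q) 0))

p+q<2*[p⊔q] : ∀ {p q} → p ≢ q → p + q < 2 * (p ⊔ q)
p+q<2*[p⊔q] {p} {q} p≢q with <-cmp p q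
... | tri< p<q _ _ = subst (λ m → p + q < 2 * m) (sym (m≤n⇒m⊔n≡n (<⇒≤ p<q)))
                       (≤-trans (+-monoˡ-< q p<q) (≤-reflexive (cong (q +_) (sym (+-identityʳ q)))))
... | tri≈ _ p≡q _ = ⊥-elim (p≢q p≡q)
... | tri> _ _ q<p = subst (λ m → p + q < 2 * m) (sym (m≥n⇒m⊔n≡m (<⇒≤ q<p)))
                       (≤-trans (+-monoʳ-< p q<p) (≤-reflexive (cong (p +_) (sym (+-identityʳ p)))))

clearance-≥ : ∀ p q → suc (p + q) ≤ clearance p q
clearance-≥ p q = s≤s (p+q≤2*[p⊔q] p q)

clearance-> : ∀ {p q} → p ≢ q → 2 + (p + q) ≤ clearance p q
clearance-> p≢q = s≤s (p+q<2*[p⊔q] p≢q)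

pathClearance-≥ : ∀ p qs → 2 * sum (p ∷ qs) + length qs ≤ pathClearance (p ∷ qs) + (p + lastOr p qs)
pathClearance-≥ p []       = ≤-reflexive (double p)
  where
  double : ∀ p → 2 * (p + 0) + 0 ≡ 0 + (p + p)
  double = solve-∀
pathClearance-≥ p (q ∷ qs) = begin
  2 * (p + s) + suc ℓ             ≡⟨ regroup₁ p s ℓ ⟩
  suc (p + p) + (2 * s + ℓ)       ≤⟨ +-monoʳ-≤ (suc (p + p)) (pathClearance-≥ q qs) ⟩
  suc (p + p) + (X + (q + L))     ≡⟨ regroup₂ p q X L ⟩
  suc (p + q) + X + (p + L)       ≤⟨ +-monoˡ-≤ (p + L) (+-monoˡ-≤ X (clearance-≥ p q)) ⟩
  clearance p q + X + (p + L)     ∎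
  where
  open ≤-Reasoning
  s = sum (q ∷ qs)
  ℓ = length qs
  X = pathClearance (q ∷ qs)
  L = lastOr q qs
  regroup₁ : ∀ p s ℓ → 2 * (p + s) + suc ℓ ≡ suc (p + p) + (2 * s + ℓ)
  regroup₁ = solve-∀
  regroup₂ : ∀ p q X L → suc (p + p) + (X + (q + L)) ≡ suc (p + q) + X + (p + L)
  regroup₂ = solve-∀

cycleClearance-≥ : ∀ p qs → 2 * sum (p ∷ qs) + suc (length qs) ≤ cycleClearance p qs
cycleClearance-≥ p qs = begin
  2 * σ + suc (length qs)   ≡⟨ +-suc (2 * σ) (length qs) ⟩
  suc (2 * σ + length qs)   ≤⟨ s≤s (pathClearance-≥ p qs) ⟩
  suc (X + (p + L))         ≡⟨ +-suc X (p + L) ⟨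
  X + suc (p + L)           ≤⟨ +-monoʳ-≤ X (clearance-≥ p L) ⟩
  X + clearance p L         ∎
  where
  open ≤-Reasoning
  σ = sum (p ∷ qs)
  X = pathClearance (p ∷ qs)
  L = lastOr p qs

cycleClearance-three-≥ : ∀ p q r e₁ e₂ e₃ →
  e₁ + suc (p + q) ≤ clearance p q → e₂ + suc (q + r) ≤ clearance q r → e₃ + suc (p + r) ≤ clearance p r →
  2 * sum (p ∷ q ∷ r ∷ []) + (3 + (e₁ + e₂ + e₃)) ≤ cycleClearance p (q ∷ r ∷ [])
cycleClearance-three-≥ p q r e₁ e₂ e₃ pq qr pr =
  ≤-trans (≤-reflexive (regroup p q r e₁ e₂ e₃)) (+-mono-≤ (+-mono-≤ pq (+-monoˡ-≤ 0 qr)) pr)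
  where
  regroup : ∀ p q r e₁ e₂ e₃ → 2 * (p + (q + (r + 0))) + (3 + (e₁ + e₂ + e₃)) ≡
    e₁ + suc (p + q) + (e₂ + suc (q + r) + 0) + (e₃ + suc (p + r))
  regroup = solve-∀

-- A non-constant triangle has at least two unequal sides, each contributing one unit of slack.
cycleClearance-≥-nonconstant : ∀ p q r → ¬ (p ≡ q × q ≡ r) →
  2 * sum (p ∷ q ∷ r ∷ []) + 5 ≤ cycleClearance p (q ∷ r ∷ [])
cycleClearance-≥-nonconstant p q r nonconstant with p ≟ q | q ≟ r
... | yes refl | yes refl = ⊥-elim (nonconstant (refl , refl))
... | yes refl | no q≢r =
  cycleClearance-three-≥ p q r 0 1 1 (clearance-≥ p q) (clearance-> q≢r) (clearance-> q≢r)
... | no p≢q   | yes refl =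
  cycleClearance-three-≥ p q r 1 0 1 (clearance-> p≢q) (clearance-≥ q r) (clearance-> p≢q)
... | no p≢q   | no q≢r =
  cycleClearance-three-≥ p q r 1 1 0 (clearance-> p≢q) (clearance-> q≢r) (clearance-≥ p r)

halve-bound : ∀ {a} σ k → 2 * σ + 2 * k ≤ suc (2 * a) → σ + k ≤ a
halve-bound σ k bound = half-≤ (≤-trans (≤-reflexive (*-distribˡ-+ 2 σ k)) bound)

two-cycle-bound : ∀ {a} p q → Admissible a (p ∷ q ∷ []) → suc (2 * (p ⊔ q)) ≤ a
two-cycle-bound p q adm = half-≤ (≤-trans (≤-reflexive (+-comm D (D + 0))) adm)
  where D = clearance p q

long-cycle-bound : ∀ {a} p q r rs → Admissible a (p ∷ q ∷ r ∷ rs) → sum (p ∷ q ∷ r ∷ rs) + 1 ≤ a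
long-cycle-bound p q r rs adm = halve-bound σ 1
  (≤-trans (+-monoʳ-≤ (2 * σ) (s≤s (s≤s z≤n))) (≤-trans (cycleClearance-≥ p (q ∷ r ∷ rs)) adm))
  where σ = sum (p ∷ q ∷ r ∷ rs)

longer-cycle-bound : ∀ {a} p q r s rs → Admissible a (p ∷ q ∷ r ∷ s ∷ rs) → sum (p ∷ q ∷ r ∷ s ∷ rs) + 2 ≤ a
longer-cycle-bound p q r s rs adm = halve-bound σ 2
  (≤-trans (+-monoʳ-≤ (2 * σ) (s≤s (s≤s (s≤s (s≤s z≤n))))) (≤-trans (cycleClearance-≥ p (q ∷ r ∷ s ∷ rs)) adm))
  where σ = sum (p ∷ q ∷ r ∷ s ∷ rs)

nonconstant-triangle-bound : ∀ {a} p q r → ¬ (p ≡ q × q ≡ r) → Admissible a (p ∷ q ∷ r ∷ []) →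
  sum (p ∷ q ∷ r ∷ []) + 2 ≤ a
nonconstant-triangle-bound p q r nonconstant adm = halve-bound σ 2
  (≤-trans (+-monoʳ-≤ (2 * σ) (n≤1+n 4)) (≤-trans (cycleClearance-≥-nonconstant p q r nonconstant) adm))
  where σ = sum (p ∷ q ∷ r ∷ [])

Special : ℕ → Set
Special a = a ≡ 2 ⊎ a % 6 ≡ 4

constant-triangle-special : ∀ {a} p → 2 * ⌈ a /2⌉ ≡ a → 3 * p + 1 ≡ a → a % 6 ≡ 4
constant-triangle-special {a} p a-even 3p+1≡a with parity p
... | s , inj₁ refl = ⊥-elim (even≢odd ⌈ a /2⌉ (3 * s) (trans a-even (trans (sym 3p+1≡a) (odd s))))
  where
  odd : ∀ s → 3 * (2 * s) + 1 ≡ suc (2 * (3 * s))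
  odd = solve-∀
... | s , inj₂ refl = trans (cong (_% 6) (trans (sym 3p+1≡a) (six s))) ([m+kn]%n≡m%n 4 s 6)
  where
  six : ∀ s → 3 * suc (2 * s) + 1 ≡ 4 + s * 6
  six = solve-∀

constant-triangle-bound : ∀ {a} p → ¬ Special a → Admissible a (p ∷ p ∷ p ∷ []) →
  sum (p ∷ p ∷ p ∷ []) + 2 ≤ 2 * ⌈ a /2⌉
constant-triangle-bound {a} p nonspecial adm with 2*⌈n/2⌉≡n⊎1+n a | m≤n⇒m<n∨m≡n (long-cycle-bound p p p [] adm)
... | inj₂ 2h≡1+a | _          = ≤-trans (≤-reflexive (+-suc σ 1)) (≤-trans (s≤s (long-cycle-bound p p p [] adm)) (≤-reflexive (sym 2h≡1+a)))
  where σ = sum (p ∷ p ∷ p ∷ [])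
... | inj₁ 2h≡a   | inj₁ σ+1<a = ≤-trans (≤-reflexive (+-suc σ 1)) (≤-trans σ+1<a (≤-reflexive (sym 2h≡a)))
  where σ = sum (p ∷ p ∷ p ∷ [])
... | inj₁ 2h≡a   | inj₂ σ+1≡a = ⊥-elim (nonspecial (inj₂ (constant-triangle-special p 2h≡a σ+1≡a)))

admissible-sum< : ∀ {a} ws → 2 ≤ a → Admissible a ws → sum ws < a
admissible-sum< [] 2≤a _ = ≤-trans (s≤s z≤n) 2≤a
admissible-sum< (p ∷ []) (s≤s (s≤s (z≤n {b}))) p≤h = ≤-<-trans (≤-trans (≤-reflexive (+-identityʳ p)) p≤h) (⌈n/2⌉<n b)
admissible-sum< (p ∷ q ∷ []) _ adm =
  ≤-trans (s≤s (≤-trans (≤-reflexive (cong (p +_) (+-identityʳ q))) (p+q≤2*[p⊔q] p q))) (two-cycle-bound p q adm)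
admissible-sum< (p ∷ q ∷ r ∷ rs) _ adm =
  ≤-trans (≤-reflexive (+-comm 1 (sum (p ∷ q ∷ r ∷ rs)))) (long-cycle-bound p q r rs adm)

nonspecial⇒2≤⌈a/2⌉ : ∀ {a} → 2 ≤ a → ¬ Special a → 2 ≤ ⌈ a /2⌉
nonspecial⇒2≤⌈a/2⌉ {suc (suc zero)}    (s≤s (s≤s z≤n)) nonspecial = ⊥-elim (nonspecial (inj₁ refl))
nonspecial⇒2≤⌈a/2⌉ {suc (suc (suc _))} (s≤s (s≤s z≤n)) _          = s≤s (s≤s z≤n)

admissible-sum≤-nonspecial : ∀ {a} ws → 2 ≤ a → ¬ Special a → Admissible a ws → sum ws + 2 ≤ 2 * ⌈ a /2⌉
admissible-sum≤-nonspecial {a} ws 2≤a nonspecial adm = bound ws adm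
  where
  h = ⌈ a /2⌉
  a≤2h : a ≤ 2 * h
  a≤2h = n≤2*⌈n/2⌉ a
  2≤h : 2 ≤ h
  2≤h = nonspecial⇒2≤⌈a/2⌉ 2≤a nonspecial
  bound : ∀ ws → Admissible a ws → sum ws + 2 ≤ 2 * h
  bound [] _ = ≤-trans 2≤a a≤2h
  bound (p ∷ []) p≤h = +-mono-≤ (≤-trans (≤-reflexive (+-identityʳ p)) p≤h) (≤-trans 2≤h (m≤m+n h 0))
  bound (p ∷ q ∷ []) adm = ≤-trans (+-monoˡ-≤ 2 σ≤2M) (≤-trans (≤-reflexive (sym (2*suc-comm M))) (*-monoʳ-≤ 2 M<h))
    where
    M = p ⊔ q
    σ≤2M : sum (p ∷ q ∷ []) ≤ 2 * M
    σ≤2M = ≤-trans (≤-reflexive (cong (p +_) (+-identityʳ q))) (p+q≤2*[p⊔q] p q)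
    2*suc-comm : ∀ M → 2 * suc M ≡ 2 * M + 2
    2*suc-comm = solve-∀
    M<h : suc M ≤ h
    M<h = half-≤ (≤-trans (≤-reflexive (2*suc M)) (s≤s (≤-trans (two-cycle-bound p q adm) a≤2h)))
  bound (p ∷ q ∷ r ∷ s ∷ rs) adm = ≤-trans (longer-cycle-bound p q r s rs adm) a≤2h
  bound (p ∷ q ∷ r ∷ []) adm with p ≟ q | q ≟ r
  ... | no p≢q   | _        = ≤-trans (nonconstant-triangle-bound p q r (p≢q ∘ proj₁) adm) a≤2h
  ... | yes _    | no q≢r   = ≤-trans (nonconstant-triangle-bound p q r (q≢r ∘ proj₂) adm) a≤2h
  ... | yes refl | yes refl = constant-triangle-bound p nonspecial adm

-- The circulant C(2a + 1; 1, a) in doubled coordinates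
module OddCirculant (a : ℕ) where

  N : ℕ
  N = suc (2 * a)

  open Congruence N

  G : Graph N
  G = Circulant N a

  vertex : ℕ → Fin N
  vertex m = fromℕ< (m%n<n m N)

  toℕ-vertex : ∀ m → toℕ (vertex m) ≡ m % N
  toℕ-vertex m = toℕ-fromℕ< (m%n<n m N)

  vertex≋ : ∀ m → toℕ (vertex m) ≋ m
  vertex≋ m = subst (_≋ m) (sym (toℕ-vertex m)) (m%N≋m m)

  pos : Fin N → ℕ
  pos u = (2 * toℕ u) % N

  pos<N : ∀ u → pos u < N
  pos<N u = m%n<n (2 * toℕ u) N

  pos≋ : ∀ u → pos u ≋ 2 * toℕ u
  pos≋ u = m%N≋m (2 * toℕ u)

  atPos : ℕ → Fin N
  atPos x = vertex (suc a * x)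

  pos-atPos : ∀ {x} → x < N → pos (atPos x) ≡ x
  pos-atPos {x} x<N = ≋⇒≡ (pos<N (atPos x)) x<N (begin
    pos (atPos x)                  ≈⟨ pos≋ (atPos x) ⟩
    2 * toℕ (vertex (suc a * x))   ≈⟨ *-congˡ-≋ 2 (vertex≋ (suc a * x)) ⟩
    2 * (suc a * x)                ≡⟨ halve a x ⟩
    x + x * N                      ≈⟨ m+kN≋m x x ⟩
    x                              ∎)
    where
    open ≋-Reasoning
    halve : ∀ a x → 2 * (suc a * x) ≡ x + x * suc (2 * a)
    halve = solve-∀

  atPos-pos : ∀ u → atPos (pos u) ≡ u
  atPos-pos u = toℕ-injective (≋⇒≡ (toℕ<n (atPos (pos u))) (toℕ<n u) (begin
    toℕ (vertex (suc a * pos u))   ≈⟨ vertex≋ (suc a * pos u) ⟩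
    suc a * pos u                  ≈⟨ *-congˡ-≋ (suc a) (pos≋ u) ⟩
    suc a * (2 * toℕ u)            ≡⟨ halve a (toℕ u) ⟩
    toℕ u + toℕ u * N              ≈⟨ m+kN≋m (toℕ u) (toℕ u) ⟩
    toℕ u                          ∎))
    where
    open ≋-Reasoning
    halve : ∀ a x → suc a * (2 * x) ≡ x + x * suc (2 * a)
    halve = solve-∀

  pos-injective : ∀ {u v} → pos u ≋ pos v → u ≡ v
  pos-injective {u} {v} pu≋pv = begin
    u                ≡⟨ atPos-pos u ⟨
    atPos (pos u)    ≡⟨ cong atPos (≋⇒≡ (pos<N u) (pos<N v) pu≋pv) ⟩
    atPos (pos v)    ≡⟨ atPos-pos v ⟩
    v                ∎
    where open ≡-Reasoning

  pos-step-1 : ∀ {u w} → (toℕ u + 1) % N ≡ toℕ w → pos w ≋ pos u + 2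
  pos-step-1 {u} {w} u+1≡w = begin
    pos w                        ≈⟨ pos≋ w ⟩
    2 * toℕ w                    ≡⟨ cong (2 *_) u+1≡w ⟨
    2 * ((toℕ u + 1) % N)        ≈⟨ *-congˡ-≋ 2 (m%N≋m (toℕ u + 1)) ⟩
    2 * (toℕ u + 1)              ≡⟨ *-distribˡ-+ 2 (toℕ u) 1 ⟩
    2 * toℕ u + 2                ≈⟨ +-congʳ-≋ 2 (pos≋ u) ⟨
    pos u + 2                    ∎
    where open ≋-Reasoning

  pos-step-a : ∀ {u w} → (toℕ u + a) % N ≡ toℕ w → pos u ≋ pos w + 1
  pos-step-a {u} {w} u+a≡w = ≋-sym (begin
    pos w + 1                    ≈⟨ +-congʳ-≋ 1 (pos≋ w) ⟩
    2 * toℕ w + 1                ≡⟨ cong (λ z → 2 * z + 1) u+a≡w ⟨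
    2 * ((toℕ u + a) % N) + 1    ≈⟨ +-congʳ-≋ 1 (*-congˡ-≋ 2 (m%N≋m (toℕ u + a))) ⟩
    2 * (toℕ u + a) + 1          ≡⟨ wrap (toℕ u) a ⟩
    2 * toℕ u + N                ≈⟨ m+N≋m (2 * toℕ u) ⟩
    2 * toℕ u                    ≈⟨ pos≋ u ⟨
    pos u                        ∎)
    where
    open ≋-Reasoning
    wrap : ∀ x a → 2 * (x + a) + 1 ≡ 2 * x + suc (2 * a)
    wrap = solve-∀

  next : Fin N → Fin N
  next u = vertex (toℕ u + 1)

  jump : Fin N → Fin N
  jump u = vertex (toℕ u + suc a)

  edge-next : ∀ u → G u (next u)
  edge-next u = inj₁ (sym (toℕ-vertex (toℕ u + 1)))

  jump-back : ∀ u → (toℕ (jump u) + a) % N ≡ toℕ u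
  jump-back u = ≋⇒≡ (m%n<n (toℕ (jump u) + a) N) (toℕ<n u) (begin
    (toℕ (jump u) + a) % N         ≈⟨ m%N≋m (toℕ (jump u) + a) ⟩
    toℕ (jump u) + a               ≈⟨ +-congʳ-≋ a (vertex≋ (toℕ u + suc a)) ⟩
    toℕ u + suc a + a              ≡⟨ around (toℕ u) a ⟩
    toℕ u + N                      ≈⟨ m+N≋m (toℕ u) ⟩
    toℕ u                          ∎)
    where
    open ≋-Reasoning
    around : ∀ x a → x + suc a + a ≡ x + suc (2 * a)
    around = solve-∀

  edge-jump : ∀ u → G u (jump u)
  edge-jump u = inj₂ (inj₂ (inj₂ (jump-back u)))

  pos-next : ∀ u → pos (next u) ≋ pos u + 2
  pos-next u = pos-step-1 {u} {next u} (sym (toℕ-vertex (toℕ u + 1)))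

  pos-jump : ∀ u → pos (jump u) ≋ pos u + 1
  pos-jump u = pos-step-a {jump u} {u} (jump-back u)

  G-sym : ∀ {u v} → G u v → G v u
  G-sym (inj₁ e)               = inj₂ (inj₁ e)
  G-sym (inj₂ (inj₁ e))        = inj₁ e
  G-sym (inj₂ (inj₂ (inj₁ e))) = inj₂ (inj₂ (inj₂ e))
  G-sym (inj₂ (inj₂ (inj₂ e))) = inj₂ (inj₂ (inj₁ e))

  walk-snoc : ∀ {u v w k} → Walk G u v k → G v w → Walk G u w (suc k)
  walk-snoc here         e = step e here
  walk-snoc (step e′ p)  e = step e′ (walk-snoc p e)

  walk-reverse : ∀ {u v k} → Walk G u v k → Walk G v u k
  walk-reverse here       = here
  walk-reverse (step e p) = walk-snoc (walk-reverse p) (G-sym e)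

  walk-along : ∀ t {u v} → pos v ≋ pos u + t → Walk G u v ⌈ t /2⌉
  walk-along zero {u} {v} v≋u+0 =
    subst (λ w → Walk G u w 0) (pos-injective (≋-sym (≋-trans v≋u+0 (≋-reflexive (+-identityʳ (pos u)))))) here
  walk-along (suc zero) {u} {v} v≋u+1 =
    subst (λ w → Walk G u w 1) (pos-injective (≋-trans (pos-jump u) (≋-sym v≋u+1))) (step (edge-jump u) here)
  walk-along (suc (suc t)) {u} {v} v≋u+2+t = step (edge-next u) (walk-along t (begin
    pos v                 ≈⟨ v≋u+2+t ⟩
    pos u + (2 + t)       ≡⟨ +-assoc (pos u) 2 t ⟨
    pos u + 2 + t         ≈⟨ +-congʳ-≋ t (pos-next u) ⟨
    pos (next u) + t      ∎))
    where open ≋-Reasoning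

  -- Positions x and y are at most k apart around the cycle of residues mod N.
  Within : ℕ → ℕ → ℕ → Set
  Within k x y = ∃₂ λ s t → s + t ≤ k × x + s ≋ y + t

  within-refl : ∀ {x} → Within 0 x x
  within-refl = 0 , 0 , z≤n , ≋-refl

  within-sym : ∀ {k x y} → Within k x y → Within k y x
  within-sym (s , t , s+t≤k , e) = t , s , ≤-trans (≤-reflexive (+-comm t s)) s+t≤k , ≋-sym e

  within-mono : ∀ {k l x y} → k ≤ l → Within k x y → Within l x y
  within-mono k≤l (s , t , s+t≤k , e) = s , t , ≤-trans s+t≤k k≤l , e

  within-trans : ∀ {k l x y z} → Within k x y → Within l y z → Within (k + l) x z
  within-trans {x = x} {y} {z} (s , t , s+t≤k , e) (s′ , t′ , s′+t′≤l , e′) =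
    s + s′ , t + t′ , ≤-trans (≤-reflexive (shuffle s s′ t t′)) (+-mono-≤ s+t≤k s′+t′≤l) , (begin
      x + (s + s′)    ≡⟨ +-assoc x s s′ ⟨
      x + s + s′      ≈⟨ +-congʳ-≋ s′ e ⟩
      y + t + s′      ≡⟨ shuffle′ y t s′ ⟩
      y + s′ + t      ≈⟨ +-congʳ-≋ t e′ ⟩
      z + t′ + t      ≡⟨ shuffle′ z t′ t ⟩
      z + t + t′      ≡⟨ +-assoc z t t′ ⟩
      z + (t + t′)    ∎)
    where
    open ≋-Reasoning
    shuffle : ∀ s s′ t t′ → s + s′ + (t + t′) ≡ s + t + (s′ + t′)
    shuffle = solve-∀
    shuffle′ : ∀ x y z → x + y + z ≡ x + z + y
    shuffle′ = solve-∀

  within-edge : ∀ {u w} → G u w → Within 2 (pos u) (pos w)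
  within-edge {u} {w} (inj₁ e)               = 2 , 0 , ≤-refl , ≋-sym (≋-trans (≋-reflexive (+-identityʳ (pos w))) (pos-step-1 {u} {w} e))
  within-edge {u} {w} (inj₂ (inj₁ e))        = 0 , 2 , ≤-refl , ≋-trans (≋-reflexive (+-identityʳ (pos u))) (pos-step-1 {w} {u} e)
  within-edge {u} {w} (inj₂ (inj₂ (inj₁ e))) = 0 , 1 , s≤s z≤n , ≋-trans (≋-reflexive (+-identityʳ (pos u))) (pos-step-a {u} {w} e)
  within-edge {u} {w} (inj₂ (inj₂ (inj₂ e))) = 1 , 0 , s≤s z≤n , ≋-sym (≋-trans (≋-reflexive (+-identityʳ (pos w))) (pos-step-a {w} {u} e))

  walk⇒within : ∀ {u v k} → Walk G u v k → Within (2 * k) (pos u) (pos v)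
  walk⇒within here = within-refl
  walk⇒within {k = suc k} (step e p) =
    within-mono (≤-reflexive (sym (2*suc k))) (within-trans (within-edge e) (walk⇒within p))

  within-gap : ∀ {k x y g} → x + g ≡ y → Within k x y → g ≤ k ⊎ N ≤ g + k
  within-gap {k} {x} {_} {g} refl (s , t , s+t≤k , x+s≋x+g+t) =
    Sum.map below wrapped (≋-below (+-cancelˡ-≋ x (≋-trans x+s≋x+g+t (≋-reflexive (+-assoc x g t)))))
    where
    below : g + t ≤ s → g ≤ k
    below g+t≤s = ≤-trans (m≤m+n g t) (≤-trans g+t≤s (≤-trans (m≤m+n s t) s+t≤k))
    wrapped : N ≤ g + t → N ≤ g + k
    wrapped N≤g+t = ≤-trans N≤g+t (+-monoʳ-≤ g (≤-trans (m≤n+m t s) s+t≤k))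


  within-ordered : ∀ {x y} → x ≤ y → y < N → Within a x y
  within-ordered {x} {y} x≤y y<N with m≤n⇒∃[o]m+o≡n x≤y
  ... | g , refl with g ≤? a
  ...   | yes g≤a = g , 0 , ≤-trans (≤-reflexive (+-identityʳ g)) g≤a , ≋-reflexive (sym (+-identityʳ (x + g)))
  ...   | no  g≰a = 0 , N ∸ g , N∸g≤a , ≋-sym (begin
    x + g + (N ∸ g)     ≡⟨ +-assoc x g (N ∸ g) ⟩
    x + (g + (N ∸ g))   ≡⟨ cong (x +_) (m+[n∸m]≡n g≤N) ⟩
    x + N               ≈⟨ m+N≋m x ⟩
    x                   ≡⟨ +-identityʳ x ⟨
    x + 0               ∎)
    where
    open ≋-Reasoning
    g≤N : g ≤ N
    g≤N = ≤-trans (m≤n+m g x) (<⇒≤ y<N)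
    N∸g≤a : N ∸ g ≤ a
    N∸g≤a = ≤-trans (∸-monoʳ-≤ N (≰⇒> g≰a)) (≤-reflexive (trans (m+n∸m≡n a (a + 0)) (+-identityʳ a)))

  within-positions : ∀ {x y} → x < N → y < N → Within a x y
  within-positions {x} {y} x<N y<N with ≤-total x y
  ... | inj₁ x≤y = within-ordered x≤y y<N
  ... | inj₂ y≤x = within-sym (within-ordered y≤x x<N)

  within⇒walk : ∀ {k u v} → Within k (pos u) (pos v) → ∃ λ L → L ≤ ⌈ k /2⌉ × Walk G u v L
  within⇒walk {k} {u} {v} (s , t , s+t≤k , u+s≋v+t) with ≤-total s t
  ... | inj₁ s≤t with m≤n⇒∃[o]m+o≡n s≤t
  ...   | d , refl = ⌈ d /2⌉ , ⌈n/2⌉-mono (≤-trans (m≤n+m d s) (≤-trans (m≤n+m (s + d) s) s+t≤k)) , walk-reverse (walk-along d u≋v+d)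
    where
    u≋v+d : pos u ≋ pos v + d
    u≋v+d = +-cancelʳ-≋ s (≋-trans u+s≋v+t (≋-reflexive (trans (cong (pos v +_) (+-comm s d)) (sym (+-assoc (pos v) d s)))))
  within⇒walk {k} {u} {v} (s , t , s+t≤k , u+s≋v+t) | inj₂ t≤s with m≤n⇒∃[o]m+o≡n t≤s
  ...   | d , refl = ⌈ d /2⌉ , ⌈n/2⌉-mono (≤-trans (m≤n+m d t) (≤-trans (m≤m+n (t + d) t) s+t≤k)) , walk-along d v≋u+d
    where
    v≋u+d : pos v ≋ pos u + d
    v≋u+d = +-cancelʳ-≋ t (≋-sym (≋-trans (≋-reflexive (trans (+-assoc (pos u) d t) (cong (pos u +_) (+-comm d t)))) u+s≋v+t))

  edge? : ∀ u w → Dec (G u w)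
  edge? u w = ((toℕ u + 1) % N ≟ toℕ w) ⊎-dec ((toℕ w + 1) % N ≟ toℕ u)
           ⊎-dec ((toℕ u + a) % N ≟ toℕ w) ⊎-dec ((toℕ w + a) % N ≟ toℕ u)

  walk? : ∀ k u v → Dec (Walk G u v k)
  walk? zero u v with u Fin.≟ v
  ... | yes refl = yes here
  ... | no  u≢v  = no λ { here → u≢v refl }
  walk? (suc k) u v with any? (λ w → edge? u w ×-dec walk? k w v)
  ... | yes (w , e , p) = yes (step e p)
  ... | no  none        = no λ { (step {w = w} e p) → none (w , e , p) }

  shortest-walk : ∀ {u v L} → Walk G u v L → ∃ λ d → Dist G u v d × d ≤ L
  shortest-walk {u} {v} = least-witness (λ k → walk? k u v)

  dist≤walk : ∀ {u v d L} → Dist G u v d → Walk G u v L → d ≤ L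
  dist≤walk {d = d} {L} (_ , shortest) w with d ≤? L
  ... | yes d≤L = d≤L
  ... | no  d≰L = ⊥-elim (shortest L (≰⇒> d≰L) w)

  ecc-≤ : ∀ {v m} → BoundedByEcc G v m → m ≤ ⌈ a /2⌉
  ecc-≤ {v} (u , d , dist , m≤d) =
    let L , L≤ , w = within⇒walk (within-positions (pos<N v) (pos<N u))
    in ≤-trans m≤d (≤-trans (dist≤walk dist w) L≤)

  ecc-≥ : ∀ {v} u {m} → (∀ {k} → Walk G v u k → m ≤ k) → BoundedByEcc G v m
  ecc-≥ {v} u far =
    let _ , _ , w = within⇒walk (within-positions (pos<N v) (pos<N u))
        d , dist , _ = shortest-walk w
    in u , d , dist , far (proj₁ dist)

  wide-gap⇒long-walk : ∀ {u v k} t g → Walk G u v k → pos u + g ≡ pos v →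
    suc (2 * t) ≤ g → suc (2 * t) + g ≤ N → t < k
  wide-gap⇒long-walk {k = k} t g w u+g≡v 1+2t≤g 1+2t+g≤N with within-gap u+g≡v (walk⇒within w)
  ... | inj₁ g≤2k   = 1+2m≤2n⇒m<n (≤-trans 1+2t≤g g≤2k)
  ... | inj₂ N≤g+2k = 1+2m≤2n⇒m<n (+-cancelʳ-≤ g (suc (2 * t)) (2 * k)
                        (≤-trans 1+2t+g≤N (≤-trans N≤g+2k (≤-reflexive (+-comm g (2 * k))))))

  independent⇒clearance≤gap : ∀ {f} → IsIndependentBroadcast G f → ∀ {u v g} → u ≢ v → 0 < f u → 0 < f v →
    pos v ≋ pos u + g → clearance (f u) (f v) ≤ g
  independent⇒clearance≤gap (_ , independent) {u} {v} {g} u≢v fu>0 fv>0 v≋u+g =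
    let d , dist , d≤ = shortest-walk (walk-along g v≋u+g)
    in m<⌈n/2⌉⇒1+2m≤n g (≤-trans (independent u v u≢v fu>0 fv>0 d dist) d≤)

  atPos-≢ : ∀ {x y} → x < N → y < N → x ≢ y → atPos x ≢ atPos y
  atPos-≢ {x} {y} x<N y<N x≢y atPos-x≡y =
    x≢y (trans (sym (pos-atPos x<N)) (trans (cong pos atPos-x≡y) (pos-atPos y<N)))

  cost-by-position : ∀ (f : Fin N → ℕ) → cost f ≡ sumBelow N (f ∘ atPos)
  cost-by-position f = begin
    cost f                   ≡⟨ cost≡∑ f ⟩
    ∑ f                      ≡⟨ ∑-bijection f (atPos ∘ toℕ) posFin atPos∘posFin posFin∘atPos ⟩
    ∑ {N} (f ∘ atPos ∘ toℕ)  ≡⟨ ∑∘toℕ≡sumBelow N (f ∘ atPos) ⟩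
    sumBelow N (f ∘ atPos)   ∎
    where
    open ≡-Reasoning
    posFin : Fin N → Fin N
    posFin u = vertex (2 * toℕ u)
    atPos∘posFin : ∀ u → atPos (toℕ (posFin u)) ≡ u
    atPos∘posFin u = trans (cong atPos (toℕ-vertex (2 * toℕ u))) (atPos-pos u)
    posFin∘atPos : ∀ i → posFin (atPos (toℕ i)) ≡ i
    posFin∘atPos i = toℕ-injective (trans (toℕ-vertex (2 * toℕ (atPos (toℕ i)))) (pos-atPos (toℕ<n i)))

  module _ {f : Fin N → ℕ} (independent : IsIndependentBroadcast G f) where

    weight : ℕ → ℕ
    weight x = f (atPos x)

    Broadcasting : ℕ → Set
    Broadcasting x = x < N × 0 < weight x

    clearance-descending : ∀ {x y} → y < x → Broadcasting x → Broadcasting y →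
      clearance (weight x) (weight y) + y ≤ x
    clearance-descending {x} {y} y<x (x<N , wx>0) (y<N , wy>0) = begin
      clearance (weight x) (weight y) + y   ≡⟨ cong (_+ y) (clearance-comm (weight x) (weight y)) ⟩
      clearance (weight y) (weight x) + y   ≤⟨ +-monoˡ-≤ y gap ⟩
      x ∸ y + y                             ≡⟨ m∸n+n≡m (<⇒≤ y<x) ⟩
      x                                     ∎
      where
      open ≤-Reasoning
      x≡y+[x∸y] : pos (atPos x) ≡ pos (atPos y) + (x ∸ y)
      x≡y+[x∸y] = trans (pos-atPos x<N) (trans (sym (m+[n∸m]≡n (<⇒≤ y<x))) (cong (_+ (x ∸ y)) (sym (pos-atPos y<N))))
      gap : clearance (weight y) (weight x) ≤ x ∸ y
      gap = independent⇒clearance≤gap independent (atPos-≢ y<N x<N (<⇒≢ y<x)) wy>0 wx>0 (≋-reflexive x≡y+[x∸y])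

    clearance-wrap : ∀ {x y} → y < x → Broadcasting x → Broadcasting y →
      clearance (weight x) (weight y) + x ≤ y + N
    clearance-wrap {x} {y} y<x (x<N , wx>0) (y<N , wy>0) = ≤-trans (+-monoˡ-≤ x gap) (≤-reflexive rearrange)
      where
      x+[N∸x+y]≡y+N : x + (N ∸ x + y) ≡ y + N
      x+[N∸x+y]≡y+N = trans (sym (+-assoc x (N ∸ x) y)) (trans (cong (_+ y) (m+[n∸m]≡n (<⇒≤ x<N))) (+-comm N y))
      rearrange : N ∸ x + y + x ≡ y + N
      rearrange = trans (+-comm (N ∸ x + y) x) x+[N∸x+y]≡y+N
      y≋x+[N∸x+y] : pos (atPos y) ≋ pos (atPos x) + (N ∸ x + y)
      y≋x+[N∸x+y] = begin
        pos (atPos y)                 ≡⟨ pos-atPos y<N ⟩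
        y                             ≈⟨ m+N≋m y ⟨
        y + N                         ≡⟨ x+[N∸x+y]≡y+N ⟨
        x + (N ∸ x + y)               ≡⟨ cong (_+ (N ∸ x + y)) (pos-atPos x<N) ⟨
        pos (atPos x) + (N ∸ x + y)   ∎
        where open ≋-Reasoning
      gap : clearance (weight x) (weight y) ≤ N ∸ x + y
      gap = independent⇒clearance≤gap independent (atPos-≢ x<N y<N (<⇒≢ y<x ∘ sym)) wx>0 wy>0 y≋x+[N∸x+y]

    pathClearance-≤ : ∀ x xs → All Broadcasting (x ∷ xs) → AllPairs _>_ (x ∷ xs) →
      pathClearance (map weight (x ∷ xs)) + lastOr x xs ≤ x
    pathClearance-≤ x []       _ _ = ≤-refl
    pathClearance-≤ x (y ∷ ys) (bx ∷ bys) ((y<x ∷ _) ∷ sorted) = begin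
      clearance (weight x) (weight y) + P + lastOr y ys     ≡⟨ +-assoc (clearance (weight x) (weight y)) P (lastOr y ys) ⟩
      clearance (weight x) (weight y) + (P + lastOr y ys)   ≤⟨ +-monoʳ-≤ _ (pathClearance-≤ y ys bys sorted) ⟩
      clearance (weight x) (weight y) + y                   ≤⟨ clearance-descending y<x bx (All.head bys) ⟩
      x                                                     ∎
      where
      open ≤-Reasoning
      P = pathClearance (map weight (y ∷ ys))

    cycleClearance-≤ : ∀ x y ys → All Broadcasting (x ∷ y ∷ ys) → AllPairs _>_ (x ∷ y ∷ ys) →
      cycleClearance (weight x) (map weight (y ∷ ys)) ≤ N
    cycleClearance-≤ x y ys valid@(bx ∷ bys) sorted@(below-x ∷ _) = +-cancelʳ-≤ (l + x) (P + C) N (begin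
      P + C + (l + x)      ≡⟨ shuffle P C l x ⟩
      (P + l) + (C + x)    ≤⟨ +-mono-≤ (pathClearance-≤ x (y ∷ ys) valid sorted) wrap ⟩
      x + (l + N)          ≡⟨ shuffle′ x l N ⟩
      N + (l + x)          ∎)
      where
      open ≤-Reasoning
      l = lastOr y ys
      P = pathClearance (map weight (x ∷ y ∷ ys))
      C = clearance (weight x) (lastOr (weight y) (map weight ys))
      wrap : C + x ≤ l + N
      wrap = subst (λ c → clearance (weight x) c + x ≤ l + N) (sym (lastOr-map weight y ys))
        (clearance-wrap (lastOr-All y ys below-x) bx (lastOr-All y ys bys))
      shuffle : ∀ P C l x → P + C + (l + x) ≡ (P + l) + (C + x)
      shuffle = solve-∀
      shuffle′ : ∀ x l N → x + (l + N) ≡ N + (l + x)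
      shuffle′ = solve-∀

    admissible-weights : ∀ xs → All Broadcasting xs → AllPairs _>_ xs → Admissible a (map weight xs)
    admissible-weights []           _     _      = tt
    admissible-weights (x ∷ [])     _     _      = ecc-≤ (proj₁ independent (atPos x))
    admissible-weights (x ∷ y ∷ ys) valid sorted = cycleClearance-≤ x y ys valid sorted

    cost-admissible : ∃ λ ws → Admissible a ws × cost f ≡ sum ws
    cost-admissible = map weight (support weight N)
      , admissible-weights (support weight N) (support-valid weight N) (support-descending weight N)
      , trans (cost-by-position f) (sym (sum-support weight N))

  1+a+a≡N : suc a + a ≡ N
  1+a+a≡N = cong suc (cong (a +_) (sym (+-identityʳ a)))

  ecc-mono : ∀ {v m m′} → m′ ≤ m → BoundedByEcc G v m → BoundedByEcc G v m′
  ecc-mono m′≤m (u , d , dist , m≤d) = u , d , dist , ≤-trans m′≤m m≤d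

  walk-≥⌈a/2⌉ : ∀ {u v k} g → pos u + g ≡ pos v → a ≤ g → g ≤ suc a → Walk G u v k → ⌈ a /2⌉ ≤ k
  walk-≥⌈a/2⌉ {k = k} g u+g≡v a≤g g≤1+a w = n≤2*m⇒⌈n/2⌉≤m (Sum.[ ≤-trans a≤g , wrapped ]′ (within-gap u+g≡v (walk⇒within w)))
    where
    wrapped : N ≤ g + 2 * k → a ≤ 2 * k
    wrapped N≤g+2k = +-cancelˡ-≤ (suc a) a (2 * k)
      (≤-trans (≤-reflexive 1+a+a≡N) (≤-trans N≤g+2k (+-monoˡ-≤ (2 * k) g≤1+a)))

  ecc-⌈a/2⌉ : ∀ v → BoundedByEcc G v ⌈ a /2⌉
  ecc-⌈a/2⌉ v with pos v + a <? N
  ... | yes v+a<N = ecc-≥ (atPos (pos v + a)) (walk-≥⌈a/2⌉ a (sym (pos-atPos v+a<N)) ≤-refl (n≤1+n a))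
  ... | no  v+a≮N = ecc-≥ (atPos y) (walk-≥⌈a/2⌉ (suc a) y+1+a≡v (n≤1+n a) ≤-refl ∘ walk-reverse)
    where
    1+a≤v : suc a ≤ pos v
    1+a≤v = +-cancelʳ-≤ a (suc a) (pos v) (≤-trans (≤-reflexive 1+a+a≡N) (≮⇒≥ v+a≮N))
    y = pos v ∸ suc a
    y+1+a≡v : pos (atPos y) + suc a ≡ pos v
    y+1+a≡v = trans (cong (_+ suc a) (pos-atPos (≤-<-trans (m∸n≤m (pos v) (suc a)) (pos<N v)))) (m∸n+n≡m 1+a≤v)

  -- Both the gap g from x to y and the complementary gap N - g exceed 2t, so walks between them need more than t steps.
  Apart : ℕ → ℕ → ℕ → Set
  Apart t x y = ∃ λ g → x + g ≡ y × suc (2 * t) ≤ g × suc (2 * t) + g ≤ N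

  apart⇒≢ : ∀ {t x y} → Apart t x y → x ≢ y
  apart⇒≢ {x = x} (g , x+g≡y , 1+2t≤g , _) x≡y =
    <⇒≢ (≤-trans (s≤s z≤n) 1+2t≤g) (sym (+-cancelˡ-≡ x g 0 (trans x+g≡y (trans (sym x≡y) (sym (+-identityʳ x))))))

  apart-walk : ∀ {t u v k} → Apart t (pos u) (pos v) → Walk G u v k → t < k
  apart-walk {t} (g , u+g≡v , 1+2t≤g , 1+2t+g≤N) w = wide-gap⇒long-walk t g w u+g≡v 1+2t≤g 1+2t+g≤N

  beacons : ℕ → List ℕ → Fin N → ℕ
  beacons t cs v = spread t cs (pos v)

  beacons-independent : ∀ t cs → t ≤ ⌈ a /2⌉ → AllPairs (Apart t) cs → IsIndependentBroadcast G (beacons t cs)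
  beacons-independent t cs t≤⌈a/2⌉ apart = broadcast , independent
    where
    distinct : AllPairs _≢_ cs
    distinct = AllPairs.map (apart⇒≢ {t}) apart
    beacons≤t : ∀ v → beacons t cs v ≤ t
    beacons≤t v = spread-≤ t (pos v) distinct
    broadcast : IsBroadcast G (beacons t cs)
    broadcast v = ecc-mono (≤-trans (beacons≤t v) t≤⌈a/2⌉) (ecc-⌈a/2⌉ v)
    independent : ∀ u v → u ≢ v → 0 < beacons t cs u → 0 < beacons t cs v →
      ∀ d → Dist G u v d → (beacons t cs u ⊔ beacons t cs v) < d
    independent u v u≢v u>0 v>0 d (w , _) = ≤-<-trans (⊔-lub (beacons≤t u) (beacons≤t v))
      (Sum.[ (λ uv → apart-walk uv w) , (λ vu → apart-walk vu (walk-reverse w)) ]′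
        (AllPairs-∈ apart (spread-pos t cs (pos u) u>0) (spread-pos t cs (pos v) v>0) (u≢v ∘ pos-injective ∘ ≋-reflexive)))

  beacons-cost : ∀ t cs → All (_< N) cs → cost (beacons t cs) ≡ length cs * t
  beacons-cost t cs cs<N = begin
    cost (beacons t cs)                        ≡⟨ cost-by-position (beacons t cs) ⟩
    sumBelow N (λ x → spread t cs (pos (atPos x)))  ≡⟨ sumBelow-cong N (λ x<N → cong (spread t cs) (pos-atPos x<N)) ⟩
    sumBelow N (spread t cs)                   ≡⟨ sumBelow-spread t cs N cs<N ⟩
    length cs * t                              ∎
    where open ≡-Reasoning

  beacon-broadcast : ∀ t cs → t ≤ ⌈ a /2⌉ → All (_< N) cs → AllPairs (Apart t) cs →
    Σ (Fin N → ℕ) λ f → IsIndependentBroadcast G f × cost f ≡ length cs * t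
  beacon-broadcast t cs t≤⌈a/2⌉ cs<N apart =
    beacons t cs , beacons-independent t cs t≤⌈a/2⌉ apart , beacons-cost t cs cs<N

IndependentBroadcastOfCost : ℕ → ℕ → Set
IndependentBroadcastOfCost a c =
  Σ (Fin (suc (2 * a)) → ℕ) λ f → IsIndependentBroadcast (Circulant (suc (2 * a)) a) f × cost f ≡ c

one-beacon : IndependentBroadcastOfCost 2 1
one-beacon = OddCirculant.beacon-broadcast 2 1 (0 ∷ []) ≤-refl (s≤s z≤n ∷ []) ([] ∷ [])

two-beacons : ∀ a → 2 ≤ a → IndependentBroadcastOfCost a (2 * (⌈ a /2⌉ ∸ 1))
two-beacons a@(suc (suc b)) (s≤s (s≤s z≤n)) =
  beacon-broadcast t (0 ∷ 2 * h ∷ []) (n≤1+n t) (s≤s z≤n ∷ 2h<N ∷ []) ((apart ∷ []) ∷ [] ∷ [])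
  where
  open OddCirculant a
  t = ⌈ b /2⌉
  h = suc t
  2h≤1+a : 2 * h ≤ suc a
  2h≤1+a = 2*⌈n/2⌉≤1+n a
  2h<N : 2 * h < N
  2h<N = s≤s (≤-trans 2h≤1+a (m+n≡o⇒m≤o (suc a) (double b)))
    where
    double : ∀ b → suc (suc (suc b)) + suc b ≡ 2 * suc (suc b)
    double = solve-∀
  apart : Apart t 0 (2 * h)
  apart = 2 * h , refl , ≤-trans (n≤1+n (suc (2 * t))) (≤-reflexive (sym (2*suc t))) , s≤s⁻¹ (begin
    suc (suc (2 * t) + 2 * h)   ≡⟨ regroup t ⟩
    2 * h + 2 * h               ≤⟨ +-mono-≤ 2h≤1+a 2h≤1+a ⟩
    suc a + suc a               ≡⟨ regroup′ a ⟩
    suc N                       ∎)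
    where
    open ≤-Reasoning
    regroup : ∀ t → suc (suc (2 * t) + 2 * suc t) ≡ 2 * suc t + 2 * suc t
    regroup = solve-∀
    regroup′ : ∀ a → suc a + suc a ≡ suc (suc (2 * a))
    regroup′ = solve-∀

-- Strength 2m + 1 at the equally spaced positions 0, c, 2c, where N = 3c.
three-beacons : ∀ m → IndependentBroadcastOfCost (4 + m * 6) (3 + m * 6)
three-beacons m = subst (IndependentBroadcastOfCost a) (triple m)
  (beacon-broadcast t (0 ∷ c ∷ 2 * c ∷ []) t≤⌈a/2⌉ (s≤s z≤n ∷ c<N ∷ 2c<N ∷ [])
    ((apart-c ∷ apart-2c ∷ []) ∷ (apart-c′ ∷ []) ∷ [] ∷ []))
  where
  a = 4 + m * 6
  open OddCirculant a
  t = 1 + m * 2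
  c = 3 + m * 4
  triple : ∀ m → 3 * (1 + m * 2) ≡ 3 + m * 6
  triple = solve-∀
  t≤⌈a/2⌉ : t ≤ ⌈ a /2⌉
  t≤⌈a/2⌉ = 2*m≤n⇒m≤⌈n/2⌉ (m+n≡o⇒m≤o (2 * t) (e m))
    where
    e : ∀ m → 2 * (1 + m * 2) + (2 + m * 2) ≡ 4 + m * 6
    e = solve-∀
  c<N : c < N
  c<N = m+n≡o⇒m≤o (suc c) (e m)
    where
    e : ∀ m → suc (3 + m * 4) + (5 + m * 8) ≡ suc (2 * (4 + m * 6))
    e = solve-∀
  2c<N : 2 * c < N
  2c<N = m+n≡o⇒m≤o (suc (2 * c)) (e m)
    where
    e : ∀ m → suc (2 * (3 + m * 4)) + (2 + m * 4) ≡ suc (2 * (4 + m * 6))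
    e = solve-∀
  1+2t≡c : suc (2 * t) ≡ c
  1+2t≡c = e m
    where
    e : ∀ m → suc (2 * (1 + m * 2)) ≡ 3 + m * 4
    e = solve-∀
  c+2c≡N : c + 2 * c ≡ N
  c+2c≡N = e m
    where
    e : ∀ m → (3 + m * 4) + 2 * (3 + m * 4) ≡ suc (2 * (4 + m * 6))
    e = solve-∀
  gap-c : suc (2 * t) ≤ c × suc (2 * t) + c ≤ N
  gap-c = ≤-reflexive 1+2t≡c , ≤-trans (≤-reflexive (cong (_+ c) 1+2t≡c)) (m+n≡o⇒m≤o (c + c) (trans (+-assoc c c c) (trans (cong (λ x → c + (c + x)) (sym (+-identityʳ c))) c+2c≡N)))
  apart-c : Apart t 0 c
  apart-c = c , refl , gap-c
  apart-c′ : Apart t c (2 * c)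
  apart-c′ = c , cong (c +_) (sym (+-identityʳ c)) , gap-c
  apart-2c : Apart t 0 (2 * c)
  apart-2c = 2 * c , refl , ≤-trans (≤-reflexive 1+2t≡c) (m≤m+n c (c + 0)) , ≤-reflexive (trans (cong (_+ 2 * c) 1+2t≡c) c+2c≡N)

special-broadcast : ∀ {a} → Special a → IndependentBroadcastOfCost a (a ∸ 1)
special-broadcast (inj₁ refl) = one-beacon
special-broadcast {a} (inj₂ a%6≡4) =
  subst (λ a → IndependentBroadcastOfCost a (a ∸ 1)) (sym a≡4+[a/6]*6) (three-beacons (a / 6))
  where
  a≡4+[a/6]*6 : a ≡ 4 + (a / 6) * 6
  a≡4+[a/6]*6 = trans (m≡m%n+[m/n]*n a 6) (cong (_+ (a / 6) * 6) a%6≡4)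

corollary17 : ∀ (a : ℕ) → 2 ≤ a →
    ((a ≡ 2 ⊎ a % 6 ≡ 4) →
      IndepBroadcastNumberIs (Circulant (suc (2 * a)) a) (a ∸ 1)) ×
    (¬ (a ≡ 2 ⊎ a % 6 ≡ 4) →
      IndepBroadcastNumberIs (Circulant (suc (2 * a)) a) (2 * (⌈ a /2⌉ ∸ 1)))
corollary17 a 2≤a = special , nonspecial
  where
  open OddCirculant a using (cost-admissible)
  special : Special a → IndepBroadcastNumberIs (Circulant (suc (2 * a)) a) (a ∸ 1)
  special sp = special-broadcast sp , λ f independent →
    let ws , admissible , cost≡ = cost-admissible independent
    in subst (_≤ a ∸ 1) (sym cost≡) (m<n⇒m≤n∸1 (admissible-sum< ws 2≤a admissible))
  nonspecial : ¬ Special a → IndepBroadcastNumberIs (Circulant (suc (2 * a)) a) (2 * (⌈ a /2⌉ ∸ 1))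
  nonspecial ns = two-beacons a 2≤a , λ f independent →
    let ws , admissible , cost≡ = cost-admissible independent
    in subst (_≤ 2 * (⌈ a /2⌉ ∸ 1)) (sym cost≡) (+2≤2*⇒≤2*∸1 {h = ⌈ a /2⌉} (admissible-sum≤-nonspecial ws 2≤a ns admissible))
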